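{- Let $\ast$ be any of the four standard graph products (Cartesian product $G\square H$, direct product $G\times H$, lexicographic product $G\circ H$, strong product $G\boxtimes H$). No minimum counterexample to the conjecture that $\chi(G)\le \mathrm{toi}(G)$ for every graph $G$ is of the form $G \ast H$.
   Context: All graphs are finite, simple and loopless. $\mathrm{toi}(G)$ is the maximum $t$ such that $G$ contains a totally odd strong immersion of $K_t$ (an immersion where all connecting paths are odd and terminals do not appear as interior vertices of the paths), and $\chi(G)$ is the chromatic number. The conjecture (of Jiménez, Quiroz and Thraves Caro) states $\chi(G)\le\mathrm{toi}(G)$ for every graph $G$. The Cartesian product $G\square H$ has vertex set $V(G)\times V(H)$ with $(g_1,h_1)(g_2,h_2)$ an edge if $g_1=g_2$ and $h_1h_2\in E(H)$, or $h_1=h_2$ and $g_1g_2\in E(G)$; the direct product $G\times H$ has $(g_1,h_1)(g_2,h_2)$ an edge if $g_1g_2\in E(G)$ and $h_1h_2\in E(H)$; the strong product is the union of these two; the lexicographic product $G\circ H$ has $(g_1,h_1)(g_2,h_2)$ an edge if $g_1g_2\in E(G)$, or $g_1=g_2$ and $h_1h_2\in E(H)$. -}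

module Defs where

open import Data.Nat using (ℕ; zero; suc; _+_; _*_; _≤_; _<_)
open import Data.Fin using (Fin; toℕ; inject₁) renaming (suc to fsuc; _<_ to _<ᶠ_)
open import Data.Fin.Properties using (*↔×) renaming (_≟_ to _≟ᶠ_)
open import Data.Product using (Σ; ∃; _×_; _,_; proj₁; proj₂)
open import Data.Sum using (_⊎_; inj₁; inj₂)
open import Data.Empty using (⊥)
open import Relation.Nullary using (¬_; Dec; yes; no)
open import Relation.Nullary.Decidable using (via-injection; _×-dec_; _⊎-dec_)
open import Relation.Binary.PropositionalEquality using (_≡_; _≢_; refl; sym; cong)
open import Relation.Binary.PropositionalEquality.Properties using (setoid)
open import Function using (_∘_)
open import Function.Bundles using (_↔_; Inverse)
open import Function.Properties.Inverse using (↔-sym; ↔-trans; ↔⇒↣)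
open import Data.Product.Function.NonDependent.Propositional using (_×-↔_)

record Graph : Set₁ where
  field
    V     : Set
    order : ℕ
    enum  : V ↔ Fin order
    E     : V → V → Set
    E-sym   : ∀ {u v} → E u v → E v u
    E-irr   : ∀ {v} → ¬ E v v
    E-dec   : ∀ u v → Dec (E u v)

open Graph public

_≟V_ : (G : Graph) → (u v : V G) → Dec (u ≡ v)
_≟V_ G = via-injection (↔⇒↣ (enum G)) _≟ᶠ_

Colourable : Graph → ℕ → Set
Colourable G k = Σ (V G → Fin k) λ c → ∀ u v → E G u v → c u ≢ c v

IsChromaticNumber : Graph → ℕ → Set
IsChromaticNumber G k = Colourable G k × (∀ j → Colourable G j → k ≤ j)

Odd : ℕ → Set
Odd n = ∃ λ m → n ≡ suc (2 * m)

record Path (G : Graph) (u v : V G) : Set where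
  field
    len    : ℕ
    vert   : Fin (suc len) → V G
    vert-inj : ∀ a b → vert a ≡ vert b → a ≡ b
    start  : vert Fin.zero ≡ u
    end    : vert (Data.Fin.fromℕ len) ≡ v
    adj    : ∀ (k : Fin len) → E G (vert (inject₁ k)) (vert (fsuc k))
open Path public

SameEdge : {A : Set} → A → A → A → A → Set
SameEdge a b c d = (a ≡ c × b ≡ d) ⊎ (a ≡ d × b ≡ c)

record TOImmersion (G : Graph) (t : ℕ) : Set where
  field
    terminal     : Fin t → V G
    terminal-inj : ∀ i j → terminal i ≡ terminal j → i ≡ j
    path         : (i j : Fin t) → i <ᶠ j → Path G (terminal i) (terminal j)
    path-odd     : ∀ i j (p : i <ᶠ j) → Odd (len (path i j p))
    edge-disjoint : ∀ i j (p : i <ᶠ j) i' j' (p' : i' <ᶠ j') →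
                    ¬ (i ≡ i' × j ≡ j') →
                    ∀ (k : Fin (len (path i j p))) (k' : Fin (len (path i' j' p'))) →
                    ¬ SameEdge (vert (path i j p) (inject₁ k)) (vert (path i j p) (fsuc k))
                               (vert (path i' j' p') (inject₁ k')) (vert (path i' j' p') (fsuc k'))
    no-terminal-interior : ∀ i j (p : i <ᶠ j) (k : Fin (suc (len (path i j p)))) →
                    toℕ k ≢ 0 → toℕ k ≢ len (path i j p) →
                    ∀ s → vert (path i j p) k ≢ terminal s

IsToi : Graph → ℕ → Set
IsToi G t = TOImmersion G t × (∀ s → TOImmersion G s → s ≤ t)

SatisfiesConjecture : Graph → Set
SatisfiesConjecture G = ∀ k t → IsChromaticNumber G k → IsToi G t → k ≤ t

Counterexample : Graph → Set
Counterexample G = ¬ SatisfiesConjecture G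

MinimumCounterexample : Graph → Set₁
MinimumCounterexample G =
  Counterexample G × (∀ (G' : Graph) → order G' < order G → SatisfiesConjecture G')

prodEnum : (G H : Graph) → (V G × V H) ↔ Fin (order G * order H)
prodEnum G H = ↔-trans (enum G ×-↔ enum H) (↔-sym *↔×)

private
  _≟×_ : (G H : Graph) → (x y : V G × V H) → Dec (x ≡ y)
  _≟×_ G H (g , h) (g' , h') with _≟V_ G g g' | _≟V_ H h h'
  ... | yes refl | yes refl = yes refl
  ... | no ne | _ = no λ { refl → ne refl }
  ... | yes _ | no ne = no λ { refl → ne refl }

  ≢-sym : {A : Set} {a b : A} → a ≢ b → b ≢ a
  ≢-sym ne e = ne (sym e)

CartE : (G H : Graph) → V G × V H → V G × V H → Set
CartE G H (g₁ , h₁) (g₂ , h₂) = (g₁ ≡ g₂ × E H h₁ h₂) ⊎ (h₁ ≡ h₂ × E G g₁ g₂)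

DirE : (G H : Graph) → V G × V H → V G × V H → Set
DirE G H (g₁ , h₁) (g₂ , h₂) = E G g₁ g₂ × E H h₁ h₂

StrongE : (G H : Graph) → V G × V H → V G × V H → Set
StrongE G H x y = CartE G H x y ⊎ DirE G H x y

LexE : (G H : Graph) → V G × V H → V G × V H → Set
LexE G H (g₁ , h₁) (g₂ , h₂) = E G g₁ g₂ ⊎ (g₁ ≡ g₂ × E H h₁ h₂)

_□_ : Graph → Graph → Graph
G □ H = record
  { V = V G × V H ; order = order G * order H ; enum = prodEnum G H
  ; E = CartE G H
  ; E-sym = λ { (inj₁ (e , a)) → inj₁ (sym e , E-sym H a)
              ; (inj₂ (e , a)) → inj₂ (sym e , E-sym G a) }
  ; E-irr = λ { (inj₁ (_ , a)) → E-irr H a ; (inj₂ (_ , a)) → E-irr G a }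
  ; E-dec = λ { (g₁ , h₁) (g₂ , h₂) →
      ((_≟V_ G g₁ g₂) ×-dec E-dec H h₁ h₂) ⊎-dec ((_≟V_ H h₁ h₂) ×-dec E-dec G g₁ g₂) }
  }

_⨯_ : Graph → Graph → Graph
G ⨯ H = record
  { V = V G × V H ; order = order G * order H ; enum = prodEnum G H
  ; E = DirE G H
  ; E-sym = λ { (a , b) → E-sym G a , E-sym H b }
  ; E-irr = λ { (a , _) → E-irr G a }
  ; E-dec = λ { (g₁ , h₁) (g₂ , h₂) → E-dec G g₁ g₂ ×-dec E-dec H h₁ h₂ }
  }

_⊠_ : Graph → Graph → Graph
G ⊠ H = record
  { V = V G × V H ; order = order G * order H ; enum = prodEnum G H
  ; E = StrongE G H
  ; E-sym = λ { (inj₁ c) → inj₁ (E-sym (G □ H) c) ; (inj₂ d) → inj₂ (E-sym (G ⨯ H) d) }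
  ; E-irr = λ { (inj₁ c) → E-irr (G □ H) c ; (inj₂ d) → E-irr (G ⨯ H) d }
  ; E-dec = λ x y → E-dec (G □ H) x y ⊎-dec E-dec (G ⨯ H) x y
  }

_∘ᴳ_ : Graph → Graph → Graph
G ∘ᴳ H = record
  { V = V G × V H ; order = order G * order H ; enum = prodEnum G H
  ; E = LexE G H
  ; E-sym = λ { (inj₁ a) → inj₁ (E-sym G a)
              ; (inj₂ (e , a)) → inj₂ (sym e , E-sym H a) }
  ; E-irr = λ { (inj₁ a) → E-irr G a ; (inj₂ (_ , a)) → E-irr H a }
  ; E-dec = λ { (g₁ , h₁) (g₂ , h₂) →
      E-dec G g₁ g₂ ⊎-dec ((_≟V_ G g₁ g₂) ×-dec E-dec H h₁ h₂) }
  }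

data Product : Set where
  cartesian direct lexicographic strong : Product

_⟨_⟩_ : Graph → Product → Graph → Graph
G ⟨ cartesian ⟩ H     = G □ H
G ⟨ direct ⟩ H        = G ⨯ H
G ⟨ lexicographic ⟩ H = G ∘ᴳ H
G ⟨ strong ⟩ H        = G ⊠ H

{-# OPTIONS --safe #-}
module Submission where

-- Both factors of G ∗ H have fewer vertices, so in a minimum counterexample
-- they would satisfy the conjecture: each would have a c-colouring together
-- with a totally odd immersion of K_c for some c. Such certificates combine.
-- For G □ H, colour (g , h) by c g + c h mod max(a , b) and use one layer of
-- the factor with the larger immersion; for G × H, colour by one factor and
-- use min(a , b) terminals (s_i , t_i); for G ⊠ H, colour by pairs and use
-- the a·b terminals (s_i , t_p); G ⊠ H is a spanning subgraph of G ∘ H.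
--
-- A path of a product immersion walks along both factor paths at once, the
-- shorter one padded by oscillating on its last edge; as factor paths have
-- odd or zero length, both coordinates arrive together. Two such paths that
-- run along the same path in one factor, but along a path and its reverse in
-- the other, cannot meet: a common vertex visited at times k and m would force
-- k ≡ m and k + m ≡ 1 (mod 2).
--
-- Chromatic number and toi exist only classically; the argument runs under a
-- double negation, which is harmless because k ≤ t is decidable.

open import Defs
open import Data.Bool using (Bool; true; false; not; _xor_; if_then_else_)
open import Data.Bool.Properties using (not-involutive; not-distribˡ-xor; xor-same; xor-identityʳ; xor-comm)
open import Data.Fin using (Fin; toℕ; fromℕ; fromℕ<; inject₁; inject≤; combine; remQuot) renaming (suc to fsuc; _<_ to _<ᶠ_)
open import Data.Fin.Properties using (toℕ-injective; toℕ-fromℕ; toℕ-fromℕ<; toℕ-inject₁; toℕ-inject≤; toℕ<n; toℕ≤pred[n]; inject≤-injective; injective⇒≤; combine-injective; *↔×) renaming (_≟_ to _≟ᶠ_; <-cmp to <-cmpᶠ)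
open import Data.Nat using (ℕ; zero; suc; pred; _+_; _*_; _∸_; _⊔_; _⊓_; _≤_; _<_; _≟_; _≤?_; _<?_; z≤n; s≤s)
open import Data.Nat.DivMod using (_mod_; _%_; m≤n⇒m%n≡m; m<n⇒m%n≡m; m%n%n≡m%n; [m+n]%n≡m%n; %-distribˡ-+)
open import Data.Nat.Induction using (<-rec)
open import Data.Nat.Properties
open import Data.Product using (Σ; ∃; ∃-syntax; _×_; _,_; proj₁; proj₂; swap)
open import Data.Sum using (_⊎_; inj₁; inj₂; reduce; [_,_]′)
open import Effect.Monad using (RawMonad)
open import Function using (_∘_)
open import Function.Bundles using (Inverse; Injection)
open import Function.Properties.Inverse using (↔⇒↣)
import Level
open import Relation.Binary using (tri<; tri≈; tri>)
open import Relation.Binary.PropositionalEquality using (_≡_; _≢_; refl; sym; trans; cong; cong₂; subst; subst₂; module ≡-Reasoning)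
open import Relation.Nullary using (¬_; yes; no; contradiction)
open import Relation.Nullary.Decidable using (decidable-stable; _×-dec_; ¬¬-excluded-middle)
open import Relation.Nullary.Negation using (¬¬-Monad)

open RawMonad (¬¬-Monad {a = Level.zero}) using (pure; _>>=_)

-- Parity and bouncing

odd : ℕ → Bool
odd zero    = false
odd (suc n) = not (odd n)

odd-+ : ∀ m n → odd (m + n) ≡ odd m xor odd n
odd-+ zero    n = refl
odd-+ (suc m) n = trans (cong not (odd-+ m n)) (not-distribˡ-xor (odd m) (odd n))

odd-double : ∀ m → odd (m + m) ≡ false
odd-double m = trans (odd-+ m m) (xor-same (odd m))

Odd⇒odd : ∀ {n} → Odd n → odd n ≡ true
Odd⇒odd (m , refl) = cong not (trans (cong (λ k → odd (m + k)) (+-identityʳ m)) (odd-double m))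

odd⇒Odd : ∀ {n} → odd n ≡ true → Odd n
odd⇒Odd {suc zero}    _ = 0 , refl
odd⇒Odd {suc (suc n)} e with odd⇒Odd {n} (trans (sym (not-involutive (odd n))) e)
... | m , refl = suc m , cong (λ k → suc (suc k)) (sym (+-suc m (m + 0)))

odd⇒1≤ : ∀ {n} → odd n ≡ true → 1 ≤ n
odd⇒1≤ {suc n} _ = s≤s z≤n

odd-∸ : ∀ {m n} → m ≤ n → odd (n ∸ m) ≡ odd m xor odd n
odd-∸ {m} {n} m≤n = begin
  odd (n ∸ m)                     ≡⟨ sym (xor-cancelˡ (odd m) (odd (n ∸ m))) ⟩
  odd m xor (odd m xor odd (n ∸ m)) ≡⟨ cong (odd m xor_) (sym (odd-+ m (n ∸ m))) ⟩
  odd m xor odd (m + (n ∸ m))     ≡⟨ cong (λ k → odd m xor odd k) (m+[n∸m]≡n m≤n) ⟩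
  odd m xor odd n                 ∎
  where
  open ≡-Reasoning
  xor-cancelˡ : ∀ x y → x xor (x xor y) ≡ y
  xor-cancelˡ false y = refl
  xor-cancelˡ true  y = not-involutive y

-- The position at time n of a walk along 0, 1, …, A that afterwards
-- oscillates between A and A - 1; it keeps the parity of n as long as A ≥ 1.
bounce : ℕ → ℕ → ℕ
bounce A n = if odd (n ∸ A) then pred A else n ⊓ A

bounce-≤ : ∀ A n → bounce A n ≤ A
bounce-≤ A n with odd (n ∸ A)
... | true  = pred[n]≤n
... | false = m⊓n≤n n A

bounce-below : ∀ {A n} → n ≤ A → bounce A n ≡ n
bounce-below {A} {n} n≤A rewrite m≤n⇒m∸n≡0 n≤A = m≤n⇒m⊓n≡m n≤A

bounce-beyond : ∀ {A n} → A ≤ n → bounce A n ≡ (if odd (n ∸ A) then pred A else A)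
bounce-beyond {A} {n} A≤n = cong (if odd (n ∸ A) then pred A else_) (m≥n⇒m⊓n≡n A≤n)

bounce-end : ∀ {A L} → A ≤ L → odd (L ∸ A) ≡ false → bounce A L ≡ A
bounce-end {A} {L} A≤L even rewrite bounce-beyond A≤L | even = refl

bounce-odd : ∀ {A} n → 1 ≤ A → odd (bounce A n) ≡ odd n
bounce-odd {A} n 1≤A with ≤-total n A
... | inj₁ n≤A = cong odd (bounce-below n≤A)
... | inj₂ A≤n = begin
  odd (bounce A n)                          ≡⟨ cong odd (bounce-beyond A≤n) ⟩
  odd (if odd (n ∸ A) then pred A else A)   ≡⟨ odd-turn 1≤A (odd (n ∸ A)) ⟩
  odd A xor odd (n ∸ A)                     ≡⟨ sym (odd-+ A (n ∸ A)) ⟩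
  odd (A + (n ∸ A))                         ≡⟨ cong odd (m+[n∸m]≡n A≤n) ⟩
  odd n                                     ∎
  where
  open ≡-Reasoning
  odd-turn : ∀ {A} → 1 ≤ A → ∀ b → odd (if b then pred A else A) ≡ odd A xor b
  odd-turn {suc A} _ true  = sym (trans (xor-comm (not (odd A)) true) (not-involutive (odd A)))
  odd-turn {suc A} _ false = sym (xor-identityʳ (odd (suc A)))

bounce-step : ∀ {A} → 1 ≤ A → ∀ n → ∃[ k ] k < A × SameEdge (bounce A n) (bounce A (suc n)) k (suc k)
bounce-step {A} 1≤A n with n <? A
... | yes n<A = n , n<A , inj₁ (bounce-below (<⇒≤ n<A) , bounce-below n<A)
... | no n≮A = turn 1≤A (odd (n ∸ A)) (bounce-beyond A≤n) (trans (bounce-beyond (m≤n⇒m≤1+n A≤n)) next)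
  where
  A≤n = ≮⇒≥ n≮A
  next : (if odd (suc n ∸ A) then pred A else A) ≡ (if not (odd (n ∸ A)) then pred A else A)
  next = cong (λ k → if odd k then pred A else A) (+-∸-assoc 1 A≤n)
  turn : ∀ {A x y} → 1 ≤ A → ∀ b → x ≡ (if b then pred A else A) → y ≡ (if not b then pred A else A) →
         ∃[ k ] k < A × SameEdge x y k (suc k)
  turn {suc A} _ true  x≡ y≡ = A , ≤-refl , inj₁ (x≡ , y≡)
  turn {suc A} _ false x≡ y≡ = A , ≤-refl , inj₂ (x≡ , y≡)

SameEdge-sym : ∀ {A : Set} {a b c d : A} → SameEdge a b c d → SameEdge c d a b
SameEdge-sym (inj₁ (refl , refl)) = inj₁ (refl , refl)
SameEdge-sym (inj₂ (refl , refl)) = inj₂ (refl , refl)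

SameEdge-trans : ∀ {A : Set} {a b c d e f : A} → SameEdge a b c d → SameEdge c d e f → SameEdge a b e f
SameEdge-trans (inj₁ (refl , refl)) s                    = s
SameEdge-trans (inj₂ (refl , refl)) (inj₁ (refl , refl)) = inj₂ (refl , refl)
SameEdge-trans (inj₂ (refl , refl)) (inj₂ (refl , refl)) = inj₁ (refl , refl)

SameEdge-swapʳ : ∀ {A : Set} {a b c d : A} → SameEdge a b c d → SameEdge a b d c
SameEdge-swapʳ (inj₁ e) = inj₂ e
SameEdge-swapʳ (inj₂ e) = inj₁ e

SameEdge-map : ∀ {A B : Set} (f : A → B) {a b c d} → SameEdge a b c d → SameEdge (f a) (f b) (f c) (f d)
SameEdge-map f (inj₁ (refl , refl)) = inj₁ (refl , refl)
SameEdge-map f (inj₂ (refl , refl)) = inj₂ (refl , refl)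

SameEdge-unmap : ∀ {A B : Set} {f : A → B} → (∀ {x y} → f x ≡ f y → x ≡ y) →
                 ∀ {a b c d} → SameEdge (f a) (f b) (f c) (f d) → SameEdge a b c d
SameEdge-unmap f-inj (inj₁ (e , e')) = inj₁ (f-inj e , f-inj e')
SameEdge-unmap f-inj (inj₂ (e , e')) = inj₂ (f-inj e , f-inj e')

SameEdge-cong : ∀ {A : Set} {a a′ b b′ c c′ d d′ : A} → a ≡ a′ → b ≡ b′ → c ≡ c′ → d ≡ d′ →
                SameEdge a b c d → SameEdge a′ b′ c′ d′
SameEdge-cong refl refl refl refl se = se

SameEdge-head : ∀ {A : Set} {a b c d : A} → SameEdge a b c d → a ≡ c ⊎ a ≡ d
SameEdge-head (inj₁ (e , _)) = inj₁ e
SameEdge-head (inj₂ (e , _)) = inj₂ e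

SameEdge-loop : ∀ {A : Set} {a c d : A} → SameEdge a a c d → c ≡ d
SameEdge-loop (inj₁ (refl , refl)) = refl
SameEdge-loop (inj₂ (refl , refl)) = refl

SameEdge-ordered : ∀ {n} {i j i′ j′ : Fin n} → i <ᶠ j → i′ <ᶠ j′ → SameEdge i j i′ j′ → i ≡ i′ × j ≡ j′
SameEdge-ordered _   _     (inj₁ same)        = same
SameEdge-ordered i<j i′<j′ (inj₂ (refl , refl)) = contradiction i<j (<-asym i′<j′)

-- Paths and immersions indexed by ℕ

-- Indexing by ℕ rather than by Fin (suc length) lets a walk along the path
-- continue past its end.
record ℕPath (G : Graph) (u v : V G) : Set where
  field
    length       : ℕ
    at           : ℕ → V G
    at-injective : ∀ {m n} → m ≤ length → n ≤ length → at m ≡ at n → m ≡ n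
    at-start     : at 0 ≡ u
    at-end       : at length ≡ v
    at-adjacent  : ∀ {k} → k < length → E G (at k) (at (suc k))
open ℕPath public

module _ {G : Graph} where

  EdgeOf : ∀ {u v} → ℕPath G u v → V G → V G → Set
  EdgeOf P a b = ∃[ k ] k < length P × SameEdge a b (at P k) (at P (suc k))

  EdgeOf-SameEdge : ∀ {u v a b c d} (P : ℕPath G u v) → SameEdge a b c d → EdgeOf P c d → EdgeOf P a b
  EdgeOf-SameEdge P se (k , k< , se′) = k , k< , SameEdge-trans se se′

  EdgeOf-adjacent : ∀ {u v a b} (P : ℕPath G u v) → EdgeOf P a b → E G a b
  EdgeOf-adjacent P (k , k< , inj₁ (refl , refl)) = at-adjacent P k<
  EdgeOf-adjacent P (k , k< , inj₂ (refl , refl)) = E-sym G (at-adjacent P k<)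

  InteriorAvoids : ∀ {u v} → ℕPath G u v → (V G → Set) → Set
  InteriorAvoids P T = ∀ {k} → 0 < k → k < length P → ¬ T (at P k)

  trivial : ∀ u → ℕPath G u u
  trivial u = record
    { length = 0 ; at = λ _ → u
    ; at-injective = λ { z≤n z≤n _ → refl }
    ; at-start = refl ; at-end = refl ; at-adjacent = λ () }

  reverse : ∀ {u v} → ℕPath G u v → ℕPath G v u
  reverse P = record
    { length = length P
    ; at = λ n → at P (length P ∸ n)
    ; at-injective = λ {m} {n} m≤ n≤ e → trans (sym (m∸[m∸n]≡n m≤))
        (trans (cong (length P ∸_) (at-injective P (m∸n≤m _ m) (m∸n≤m _ n) e)) (m∸[m∸n]≡n n≤))
    ; at-start = at-end P
    ; at-end = trans (cong (at P) (n∸n≡0 (length P))) (at-start P)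
    ; at-adjacent = λ {k} k< → subst (λ i → E G (at P i) (at P (length P ∸ suc k)))
        (sym (+-∸-assoc 1 k<)) (E-sym G (at-adjacent P (subst (_≤ length P) (+-∸-assoc 1 k<) (m∸n≤m _ k))))
    }

  EdgeOf-reverse : ∀ {u v a b} (P : ℕPath G u v) → EdgeOf (reverse P) a b → EdgeOf P a b
  EdgeOf-reverse {a = a} {b} P (k , k< , se) = j , j< , SameEdge-swapʳ (subst (λ i → SameEdge a b (at P i) (at P j)) l∸k se)
    where
    j = length P ∸ suc k
    l∸k : length P ∸ k ≡ suc j
    l∸k = +-∸-assoc 1 k<
    j< : j < length P
    j< = subst (_≤ length P) l∸k (m∸n≤m (length P) k)

  Reverses : ∀ {u v} → ℕPath G v u → ℕPath G u v → Set
  Reverses Q P = length Q ≡ length P × (∀ {n} → n ≤ length P → at Q n ≡ at P (length P ∸ n))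

  reverse-Reverses : ∀ {u v} (P : ℕPath G u v) → Reverses (reverse P) P
  reverse-Reverses P = refl , λ _ → refl

  Reverses-sym : ∀ {u v} {Q : ℕPath G v u} {P : ℕPath G u v} → Reverses Q P → Reverses P Q
  Reverses-sym {Q = Q} {P} (l≡ , at≡) = sym l≡ , λ {n} n≤ → begin
    at P n                          ≡⟨ cong (at P) (sym (m∸[m∸n]≡n (subst (n ≤_) l≡ n≤))) ⟩
    at P (length P ∸ (length P ∸ n)) ≡⟨ sym (at≡ (m∸n≤m (length P) n)) ⟩
    at Q (length P ∸ n)             ≡⟨ cong (λ l → at Q (l ∸ n)) (sym l≡) ⟩
    at Q (length Q ∸ n)             ∎
    where open ≡-Reasoning

toℕ-mod : ∀ {l n} → n ≤ l → toℕ (n mod suc l) ≡ n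
toℕ-mod n≤l = trans (toℕ-fromℕ< _) (m≤n⇒m%n≡m n≤l)

mod-toℕ : ∀ {l n} (i : Fin (suc l)) → toℕ i ≡ n → n mod suc l ≡ i
mod-toℕ i refl = toℕ-injective (toℕ-mod (toℕ≤pred[n] i))

mod-step : ∀ {l k} (k< : k < l) → k mod suc l ≡ inject₁ (fromℕ< k<) × suc k mod suc l ≡ fsuc (fromℕ< k<)
mod-step k< = mod-toℕ _ (trans (toℕ-inject₁ (fromℕ< k<)) (toℕ-fromℕ< k<)) , mod-toℕ _ (cong suc (toℕ-fromℕ< k<))

module _ {G : Graph} {u v : V G} where

  toPath : ℕPath G u v → Path G u v
  toPath P = record
    { len = length P
    ; vert = at P ∘ toℕ
    ; vert-inj = λ a b e → toℕ-injective (at-injective P (toℕ≤pred[n] a) (toℕ≤pred[n] b) e)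
    ; start = at-start P
    ; end = trans (cong (at P) (toℕ-fromℕ (length P))) (at-end P)
    ; adj = λ k → subst (λ i → E G (at P i) (at P (suc (toℕ k)))) (sym (toℕ-inject₁ k)) (at-adjacent P (toℕ<n k))
    }

  toPath-edge : (P : ℕPath G u v) (k : Fin (length P)) →
                EdgeOf P (vert (toPath P) (inject₁ k)) (vert (toPath P) (fsuc k))
  toPath-edge P k = toℕ k , toℕ<n k , inj₁ (cong (at P) (toℕ-inject₁ k) , refl)

  -- Indices beyond the last vertex are read modulo the number of vertices;
  -- only indices up to len P are ever used.
  fromPath : Path G u v → ℕPath G u v
  fromPath P = record
    { length = len P
    ; at = λ n → vert P (n mod suc (len P))
    ; at-injective = λ m≤ n≤ e → trans (sym (toℕ-mod m≤)) (trans (cong toℕ (vert-inj P _ _ e)) (toℕ-mod n≤))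
    ; at-start = trans (cong (vert P) (mod-toℕ Fin.zero refl)) (start P)
    ; at-end = trans (cong (vert P) (mod-toℕ (fromℕ (len P)) (toℕ-fromℕ (len P)))) (end P)
    ; at-adjacent = λ k< → subst₂ (E G) (cong (vert P) (sym (proj₁ (mod-step k<))))
                                         (cong (vert P) (sym (proj₂ (mod-step k<)))) (adj P (fromℕ< k<))
    }

  fromPath-edge : ∀ {a b} (P : Path G u v) → EdgeOf (fromPath P) a b →
                  ∃[ k ] SameEdge a b (vert P (inject₁ k)) (vert P (fsuc k))
  fromPath-edge P (k , k< , se) =
    fromℕ< k< , SameEdge-trans se (inj₁ (cong (vert P) (proj₁ (mod-step k<)) , cong (vert P) (proj₂ (mod-step k<))))

record ℕImmersion (G : Graph) (t : ℕ) : Set where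
  field
    terminal           : Fin t → V G
    terminal-injective : ∀ {i j} → terminal i ≡ terminal j → i ≡ j
    route              : ∀ i j → i <ᶠ j → ℕPath G (terminal i) (terminal j)
    route-odd          : ∀ {i j} (p : i <ᶠ j) → odd (length (route i j p)) ≡ true
    route-disjoint     : ∀ {i j i′ j′ a b} (p : i <ᶠ j) (p′ : i′ <ᶠ j′) →
                         EdgeOf (route i j p) a b → EdgeOf (route i′ j′ p′) a b → i ≡ i′ × j ≡ j′
    route-interior     : ∀ {i j} (p : i <ᶠ j) → InteriorAvoids (route i j p) (λ x → ∃[ s ] x ≡ terminal s)
open ℕImmersion public

Terminal : ∀ {G t} → ℕImmersion G t → V G → Set
Terminal I x = ∃[ s ] x ≡ terminal I s

module _ {G : Graph} {t : ℕ} where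

  toTOImmersion : ℕImmersion G t → TOImmersion G t
  toTOImmersion I = record
    { terminal = terminal I
    ; terminal-inj = λ _ _ → terminal-injective I
    ; path = λ i j p → toPath (route I i j p)
    ; path-odd = λ _ _ p → odd⇒Odd (route-odd I p)
    ; edge-disjoint = λ i j p i′ j′ p′ different k k′ se → different
        (route-disjoint I p p′ (toPath-edge (route I i j p) k)
                                  (EdgeOf-SameEdge (route I i′ j′ p′) se (toPath-edge (route I i′ j′ p′) k′)))
    ; no-terminal-interior = λ i j p k k≢0 k≢l s e →
        route-interior I p (n≢0⇒n>0 k≢0) (≤∧≢⇒< (toℕ≤pred[n] k) k≢l) (s , e)
    }

  fromTOImmersion : TOImmersion G t → ℕImmersion G t
  fromTOImmersion I = record
    { terminal = T.terminal I
    ; terminal-injective = T.terminal-inj I _ _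
    ; route = λ i j p → fromPath (T.path I i j p)
    ; route-odd = λ p → Odd⇒odd (T.path-odd I _ _ p)
    ; route-disjoint = λ {i} {j} {i′} {j′} p p′ e e′ →
        decidable-stable ((i ≟ᶠ i′) ×-dec (j ≟ᶠ j′)) λ different →
          let (k , se) = fromPath-edge (T.path I i j p) e
              (k′ , se′) = fromPath-edge (T.path I i′ j′ p′) e′
          in T.edge-disjoint I i j p i′ j′ p′ different k k′ (SameEdge-trans (SameEdge-sym se) se′)
    ; route-interior = λ {i} {j} p {k} 0<k k< (s , e) →
        T.no-terminal-interior I i j p (k mod suc (len (T.path I i j p)))
          (λ k≡0 → >⇒≢ 0<k (trans (sym (toℕ-mod (<⇒≤ k<))) k≡0))
          (λ k≡l → <⇒≢ k< (trans (sym (toℕ-mod (<⇒≤ k<))) k≡l)) s e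
    }
    where module T = TOImmersion

-- Colourings and immersions

record Homomorphism (G H : Graph) : Set where
  field
    map      : V G → V H
    map-edge : ∀ {u v} → E G u v → E H (map u) (map v)
open Homomorphism public

Embedding : Graph → Graph → Set
Embedding G H = Σ (Homomorphism G H) λ φ → ∀ {u v} → map φ u ≡ map φ v → u ≡ v

Colourable-pullback : ∀ {G H k} → Homomorphism G H → Colourable H k → Colourable G k
Colourable-pullback φ (c , proper) = c ∘ map φ , λ _ _ e → proper _ _ (map-edge φ e)

Colourable-weaken : ∀ {G k l} → k ≤ l → Colourable G k → Colourable G l
Colourable-weaken k≤l (c , proper) =
  (λ v → inject≤ (c v) k≤l) , λ u v e same → proper u v e (inject≤-injective k≤l k≤l _ _ same)

enum-injective : ∀ G {u v} → Inverse.to (enum G) u ≡ Inverse.to (enum G) v → u ≡ v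
enum-injective G = Injection.injective (↔⇒↣ (enum G))

Colourable-order : ∀ G → Colourable G (order G)
Colourable-order G = Inverse.to (enum G) , λ u v e same → E-irr G (subst (E G u) (sym (enum-injective G same)) e)

TOImmersion-map : ∀ {G H t} → Embedding G H → TOImmersion G t → TOImmersion H t
TOImmersion-map {G} {H} (φ , injective) I = record
  { terminal = map φ ∘ T.terminal I
  ; terminal-inj = λ i j e → T.terminal-inj I i j (injective e)
  ; path = λ i j p → mapPath (T.path I i j p)
  ; path-odd = T.path-odd I
  ; edge-disjoint = λ i j p i′ j′ p′ different k k′ se →
      T.edge-disjoint I i j p i′ j′ p′ different k k′ (SameEdge-unmap injective se)
  ; no-terminal-interior = λ i j p k k≢0 k≢l s e → T.no-terminal-interior I i j p k k≢0 k≢l s (injective e)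
  }
  where
  module T = TOImmersion
  mapPath : ∀ {u v} → Path G u v → Path H (map φ u) (map φ v)
  mapPath P = record
    { len = len P ; vert = map φ ∘ vert P
    ; vert-inj = λ a b e → vert-inj P a b (injective e)
    ; start = cong (map φ) (start P) ; end = cong (map φ) (end P)
    ; adj = λ k → map-edge φ (adj P k) }

TOImmersion-restrict : ∀ {G t m} → m ≤ t → TOImmersion G t → TOImmersion G m
TOImmersion-restrict {G} {t} {m} m≤t I = record
  { terminal = T.terminal I ∘ ι
  ; terminal-inj = λ i j e → ι-injective (T.terminal-inj I _ _ e)
  ; path = λ i j p → T.path I (ι i) (ι j) (ι-mono p)
  ; path-odd = λ i j p → T.path-odd I _ _ (ι-mono p)
  ; edge-disjoint = λ i j p i′ j′ p′ different → T.edge-disjoint I _ _ (ι-mono p) _ _ (ι-mono p′)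
      λ (e , e′) → different (ι-injective e , ι-injective e′)
  ; no-terminal-interior = λ i j p k k≢0 k≢l s → T.no-terminal-interior I _ _ (ι-mono p) k k≢0 k≢l (ι s)
  }
  where
  module T = TOImmersion
  ι : Fin m → Fin t
  ι i = inject≤ i m≤t
  ι-injective : ∀ {i j} → ι i ≡ ι j → i ≡ j
  ι-injective = inject≤-injective m≤t m≤t _ _
  ι-mono : ∀ {i j} → i <ᶠ j → ι i <ᶠ ι j
  ι-mono {i} {j} = subst₂ _<_ (sym (toℕ-inject≤ i m≤t)) (sym (toℕ-inject≤ j m≤t))

TOImmersion-empty : ∀ {G} → TOImmersion G 0
TOImmersion-empty = record
  { terminal = λ () ; terminal-inj = λ () ; path = λ () ; path-odd = λ ()
  ; edge-disjoint = λ () ; no-terminal-interior = λ () }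

TOImmersion-≤order : ∀ {G t} → TOImmersion G t → t ≤ order G
TOImmersion-≤order {G} I = injective⇒≤ λ e → TOImmersion.terminal-inj I _ _ (enum-injective G e)

Least : (ℕ → Set) → ℕ → Set
Least P k = P k × (∀ j → P j → k ≤ j)

Greatest : (ℕ → Set) → ℕ → Set
Greatest P t = P t × (∀ s → P s → s ≤ t)

¬¬-least : ∀ {P : ℕ → Set} n → P n → ¬ ¬ ∃ (Least P)
¬¬-least {P} = <-rec (λ n → P n → ¬ ¬ ∃ (Least P)) λ n smaller pn →
  ¬¬-excluded-middle {A = ∃[ m ] m < n × P m} >>= λ where
    (yes (m , m<n , pm)) → smaller m<n pm
    (no none)            → pure (n , pn , λ j pj → ≮⇒≥ λ j<n → none (j , j<n , pj))

-- The greatest element of P is N ∸ k for the least k with P (N ∸ k).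
¬¬-greatest : ∀ {P : ℕ → Set} {n} N → (∀ s → P s → s ≤ N) → P n → ¬ ¬ ∃ (Greatest P)
¬¬-greatest {P} {n} N bounded pn = ¬¬-least {λ k → P (N ∸ k)} (N ∸ n) (reflect pn) >>= λ (k , pk , least) →
  pure (N ∸ k , pk , λ s ps →
    subst (_≤ N ∸ k) (m∸[m∸n]≡n (bounded s ps)) (∸-monoʳ-≤ N (least (N ∸ s) (reflect ps))))
  where
  reflect : ∀ {s} → P s → P (N ∸ (N ∸ s))
  reflect {s} ps = subst P (sym (m∸[m∸n]≡n (bounded s ps))) ps

¬¬-chromaticNumber : ∀ G → ¬ ¬ ∃ (IsChromaticNumber G)
¬¬-chromaticNumber G = ¬¬-least (order G) (Colourable-order G)

¬¬-toi : ∀ G → ¬ ¬ ∃ (IsToi G)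
¬¬-toi G = ¬¬-greatest (order G) (λ _ → TOImmersion-≤order) TOImmersion-empty

_⊕_ : ∀ {n} → Fin n → Fin n → Fin n
_⊕_ {suc n} i j = (toℕ i + toℕ j) mod suc n

⊕-comm : ∀ {n} (i j : Fin n) → i ⊕ j ≡ j ⊕ i
⊕-comm {suc n} i j = cong (_mod suc n) (+-comm (toℕ i) (toℕ j))

-- Adding N ∸ x modulo N undoes adding x.
⊕-cancelˡ : ∀ {n} (i : Fin n) {j k} → i ⊕ j ≡ i ⊕ k → j ≡ k
⊕-cancelˡ {suc n} i {j} {k} eq = toℕ-injective (begin
  toℕ j                  ≡⟨ sym (undo (toℕ<n j)) ⟩
  shift ((x + toℕ j) % N) ≡⟨ cong shift toℕ-eq ⟩
  shift ((x + toℕ k) % N) ≡⟨ undo (toℕ<n k) ⟩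
  toℕ k                  ∎)
  where
  open ≡-Reasoning
  N = suc n
  x = toℕ i
  toℕ-eq : (x + toℕ j) % N ≡ (x + toℕ k) % N
  toℕ-eq = trans (sym (toℕ-fromℕ< _)) (trans (cong toℕ eq) (toℕ-fromℕ< _))
  shift : ℕ → ℕ
  shift r = ((N ∸ x) + r) % N
  undo : ∀ {y} → y < N → shift ((x + y) % N) ≡ y
  undo {y} y<N = begin
    ((N ∸ x) + (x + y) % N) % N         ≡⟨ %-distribˡ-+ (N ∸ x) ((x + y) % N) N ⟩
    ((N ∸ x) % N + (x + y) % N % N) % N ≡⟨ cong (λ r → ((N ∸ x) % N + r) % N) (m%n%n≡m%n (x + y) N) ⟩
    ((N ∸ x) % N + (x + y) % N) % N     ≡⟨ sym (%-distribˡ-+ (N ∸ x) (x + y) N) ⟩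
    ((N ∸ x) + (x + y)) % N             ≡⟨ cong (_% N) (sym (+-assoc (N ∸ x) x y)) ⟩
    ((N ∸ x) + x + y) % N               ≡⟨ cong (λ r → (r + y) % N) (m∸n+n≡m (<⇒≤ (toℕ<n i))) ⟩
    (N + y) % N                         ≡⟨ cong (_% N) (+-comm N y) ⟩
    (y + N) % N                         ≡⟨ [m+n]%n≡m%n y N ⟩
    y % N                               ≡⟨ m<n⇒m%n≡m y<N ⟩
    y                                   ∎

Colourable-□ : ∀ {G H n} → Colourable G n → Colourable H n → Colourable (G □ H) n
Colourable-□ {G} {H} (cG , properG) (cH , properH) = (λ (g , h) → cG g ⊕ cH h) , proper
  where
  proper : ∀ x y → CartE G H x y → cG (proj₁ x) ⊕ cH (proj₂ x) ≢ cG (proj₁ y) ⊕ cH (proj₂ y)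
  proper (g , h) (g , h′) (inj₁ (refl , e)) same = properH h h′ e (⊕-cancelˡ (cG g) same)
  proper (g , h) (g′ , h) (inj₂ (refl , e)) same =
    properG g g′ e (⊕-cancelˡ (cH h) (trans (⊕-comm (cH h) (cG g)) (trans same (⊕-comm (cG g′) (cH h)))))

Colourable-∘ᴳ : ∀ {G H a b} → Colourable G a → Colourable H b → Colourable (G ∘ᴳ H) (a * b)
Colourable-∘ᴳ {G} {H} (cG , properG) (cH , properH) = (λ (g , h) → combine (cG g) (cH h)) , proper
  where
  proper : ∀ x y → LexE G H x y → combine (cG (proj₁ x)) (cH (proj₂ x)) ≢ combine (cG (proj₁ y)) (cH (proj₂ y))
  proper (g , h) (g′ , h′) (inj₁ e)       same = properG g g′ e (proj₁ (combine-injective (cG g) (cH h) (cG g′) (cH h′) same))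
  proper (g , h) (g′ , h′) (inj₂ (_ , e)) same = properH h h′ e (proj₂ (combine-injective (cG g) (cH h) (cG g′) (cH h′) same))

⊠⇒∘ᴳ : ∀ {G H} → Homomorphism (G ⊠ H) (G ∘ᴳ H)
⊠⇒∘ᴳ {G} {H} = record { map = λ x → x ; map-edge = edge }
  where
  edge : ∀ {x y} → StrongE G H x y → LexE G H x y
  edge (inj₁ (inj₁ e))       = inj₂ e
  edge (inj₁ (inj₂ (_ , e))) = inj₁ e
  edge (inj₂ (e , _))        = inj₁ e

⨯⇒left : ∀ {G H} → Homomorphism (G ⨯ H) G
⨯⇒left = record { map = proj₁ ; map-edge = proj₁ }

⨯⇒right : ∀ {G H} → Homomorphism (G ⨯ H) H
⨯⇒right = record { map = proj₂ ; map-edge = proj₂ }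

□-layerˡ : ∀ {G H} → V H → Embedding G (G □ H)
□-layerˡ h = record { map = _, h ; map-edge = λ e → inj₂ (refl , e) } , cong proj₁

□-layerʳ : ∀ {G H} → V G → Embedding H (G □ H)
□-layerʳ g = record { map = g ,_ ; map-edge = λ e → inj₁ (refl , e) } , cong proj₂

-- Immersions in products

ZeroOrOdd : ℕ → Set
ZeroOrOdd n = n ≡ 0 ⊎ odd n ≡ true

ZeroOrOdd-⊔ : ∀ {m n} → ZeroOrOdd m → ZeroOrOdd n → ZeroOrOdd (m ⊔ n)
ZeroOrOdd-⊔ {m} {n} zm zn with ⊔-sel m n
... | inj₁ m⊔n≡m = subst ZeroOrOdd (sym m⊔n≡m) zm
... | inj₂ m⊔n≡n = subst ZeroOrOdd (sym m⊔n≡n) zn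

module _ {G : Graph} {u v : V G} (P : ℕPath G u v) where

  padded : ℕ → V G
  padded n = at P (bounce (length P) n)

  padded-below : ∀ {n} → n ≤ length P → padded n ≡ at P n
  padded-below n≤ = cong (at P) (bounce-below n≤)

  padded-injective : ∀ {m n} → m ≤ length P → n ≤ length P → padded m ≡ padded n → m ≡ n
  padded-injective m≤ n≤ e = at-injective P m≤ n≤ (trans (sym (padded-below m≤)) (trans e (padded-below n≤)))

  padded-start : padded 0 ≡ u
  padded-start = trans (padded-below z≤n) (at-start P)

  padded-trivial : length P ≡ 0 → ∀ n → padded n ≡ v
  padded-trivial l≡0 n = trans (cong (at P) bounce≡l) (at-end P)
    where
    bounce≡l : bounce (length P) n ≡ length P
    bounce≡l = trans (n≤0⇒n≡0 (subst (bounce (length P) n ≤_) l≡0 (bounce-≤ (length P) n))) (sym l≡0)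

  padded-end : ∀ {L} → length P ≤ L → ZeroOrOdd (length P) → ZeroOrOdd L → padded L ≡ v
  padded-end l≤L (inj₁ l≡0) _ = padded-trivial l≡0 _
  padded-end l≤L (inj₂ odd-l) (inj₁ refl) = contradiction (≤-trans (odd⇒1≤ odd-l) l≤L) λ ()
  padded-end {L} l≤L (inj₂ odd-l) (inj₂ odd-L) = trans (cong (at P) (bounce-end l≤L even)) (at-end P)
    where
    even : odd (L ∸ length P) ≡ false
    even = trans (odd-∸ l≤L) (subst₂ (λ a b → a xor b ≡ false) (sym odd-l) (sym odd-L) refl)

  padded-edge : 1 ≤ length P → ∀ n → EdgeOf P (padded n) (padded (suc n))
  padded-edge 1≤l n with bounce-step 1≤l n
  ... | k , k< , se = k , k< , SameEdge-map (at P) se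

  padded-adjacent : 1 ≤ length P → ∀ n → E G (padded n) (padded (suc n))
  padded-adjacent 1≤l n = EdgeOf-adjacent P (padded-edge 1≤l n)

  padded-move : ∀ n → padded n ≡ padded (suc n) ⊎ E G (padded n) (padded (suc n))
  padded-move n with length P ≟ 0
  ... | yes l≡0 = inj₁ (trans (padded-trivial l≡0 n) (sym (padded-trivial l≡0 (suc n))))
  ... | no  l≢0 = inj₂ (padded-adjacent (n≢0⇒n>0 l≢0) n)

  padded-odd : 1 ≤ length P → ∀ {k m} → padded k ≡ padded m → odd k ≡ odd m
  padded-odd 1≤l {k} {m} e = begin
    odd k                  ≡⟨ sym (bounce-odd k 1≤l) ⟩
    odd (bounce (length P) k) ≡⟨ cong odd (at-injective P (bounce-≤ _ k) (bounce-≤ _ m) e) ⟩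
    odd (bounce (length P) m) ≡⟨ bounce-odd m 1≤l ⟩
    odd m                  ∎
    where open ≡-Reasoning

padded-reverse : ∀ {G u v} {P : ℕPath G u v} {Q : ℕPath G v u} → Reverses Q P → ∀ {k m} → padded P k ≡ padded Q m →
                 bounce (length P) k + bounce (length P) m ≡ length P
padded-reverse {P = P} {Q} (l≡ , at≡) {k} {m} e = trans (cong (_+ bounce B m) position) (m∸n+n≡m (bounce-≤ B m))
  where
  B = length P
  position : bounce B k ≡ B ∸ bounce B m
  position = at-injective P (bounce-≤ B k) (m∸n≤m B (bounce B m))
    (trans e (trans (cong (λ l → at Q (bounce l m)) l≡) (at≡ (bounce-≤ B m))))

-- A vertex cannot occur at time k in the padding of Y and at time m in the
-- padding of its reverse when X has it at times of equal parity: k + m would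
-- have the parity of the odd length of Y.
padded-crossing : ∀ {G H x x′ y y′} {X : ℕPath G x x′} {Y : ℕPath H y y′} {Y′ : ℕPath H y′ y} →
                  1 ≤ length X → odd (length Y) ≡ true → Reverses Y′ Y →
                  ∀ {k m} → padded X k ≡ padded X m → padded Y k ≢ padded Y′ m
padded-crossing {X = X} {Y} {Y′} 1≤lX odd-lY rev {k} {m} eX eY = contradiction (trans (sym odd-lY) even) λ ()
  where
  open ≡-Reasoning
  B = length Y
  1≤B : 1 ≤ B
  1≤B = odd⇒1≤ odd-lY
  even : odd B ≡ false
  even = begin
    odd B                                  ≡⟨ cong odd (sym (padded-reverse {P = Y} {Y′} rev eY)) ⟩
    odd (bounce B k + bounce B m)          ≡⟨ odd-+ (bounce B k) (bounce B m) ⟩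
    odd (bounce B k) xor odd (bounce B m)  ≡⟨ cong₂ _xor_ (bounce-odd k 1≤B) (bounce-odd m 1≤B) ⟩
    odd k xor odd m                        ≡⟨ cong (odd k xor_) (sym (padded-odd X 1≤lX eX)) ⟩
    odd k xor odd k                        ≡⟨ xor-same (odd k) ⟩
    false                                  ∎

StrongE-step : ∀ {G H g g′ h h′} → g ≡ g′ ⊎ E G g g′ → h ≡ h′ ⊎ E H h h′ → E G g g′ ⊎ E H h h′ →
               StrongE G H (g , h) (g′ , h′)
StrongE-step {G} (inj₁ refl) (inj₁ refl) (inj₁ e) = contradiction e (E-irr G)
StrongE-step {H = H} (inj₁ refl) (inj₁ refl) (inj₂ e) = contradiction e (E-irr H)
StrongE-step (inj₁ g≡g′) (inj₂ eH)   _ = inj₁ (inj₁ (g≡g′ , eH))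
StrongE-step (inj₂ eG)   (inj₁ h≡h′) _ = inj₁ (inj₂ (h≡h′ , eG))
StrongE-step (inj₂ eG)   (inj₂ eH)   _ = inj₂ (eG , eH)

-- Zero-or-odd lengths make both padded walks reach their ends at time zipLength.
module Zip {G H : Graph} {x x′ y y′} (X : ℕPath G x x′) (Y : ℕPath H y y′)
           (zX : ZeroOrOdd (length X)) (zY : ZeroOrOdd (length Y)) where

  zipLength : ℕ
  zipLength = length X ⊔ length Y

  zipped : ℕ → V G × V H
  zipped n = padded X n , padded Y n

  zipped-injective : ∀ {m n} → m ≤ zipLength → n ≤ zipLength → zipped m ≡ zipped n → m ≡ n
  zipped-injective {m} {n} m≤ n≤ e with ⊔-sel (length X) (length Y)
  ... | inj₁ L≡ = padded-injective X (subst (m ≤_) L≡ m≤) (subst (n ≤_) L≡ n≤) (cong proj₁ e)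
  ... | inj₂ L≡ = padded-injective Y (subst (m ≤_) L≡ m≤) (subst (n ≤_) L≡ n≤) (cong proj₂ e)

  zipped-start : zipped 0 ≡ (x , y)
  zipped-start = cong₂ _,_ (padded-start X) (padded-start Y)

  zipped-end : zipped zipLength ≡ (x′ , y′)
  zipped-end = cong₂ _,_ (padded-end X (m≤m⊔n _ _) zX (ZeroOrOdd-⊔ zX zY))
                         (padded-end Y (m≤n⊔m _ _) zY (ZeroOrOdd-⊔ zX zY))

  zipLength-odd : ¬ (length X ≡ 0 × length Y ≡ 0) → odd zipLength ≡ true
  zipLength-odd nontrivial with ZeroOrOdd-⊔ zX zY
  ... | inj₂ odd-L = odd-L
  ... | inj₁ L≡0 = contradiction (n≤0⇒n≡0 (subst (length X ≤_) L≡0 (m≤m⊔n _ _)) ,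
                                  n≤0⇒n≡0 (subst (length Y ≤_) L≡0 (m≤n⊔m _ _))) nontrivial

  zipped-interior : ∀ {T : V G → Set} {T′ : V H → Set} → InteriorAvoids X T → InteriorAvoids Y T′ →
                    ∀ {k} → 0 < k → k < zipLength → ¬ (T (padded X k) × T′ (padded Y k))
  zipped-interior {T} {T′} avoidX avoidY {k} 0<k k< (t , t′) with ⊔-sel (length X) (length Y)
  ... | inj₁ L≡ = avoidX 0<k k<X (subst T (padded-below X (<⇒≤ k<X)) t)
    where k<X = subst (k <_) L≡ k<
  ... | inj₂ L≡ = avoidY 0<k k<Y (subst T′ (padded-below Y (<⇒≤ k<Y)) t′)
    where k<Y = subst (k <_) L≡ k<

  zipped-edgeˡ : 1 ≤ length X → ∀ {a b k} → SameEdge a b (zipped k) (zipped (suc k)) → EdgeOf X (proj₁ a) (proj₁ b)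
  zipped-edgeˡ 1≤lX {k = k} se = EdgeOf-SameEdge X (SameEdge-map proj₁ se) (padded-edge X 1≤lX k)

  zipped-step : ∀ {k} → k < zipLength → E G (padded X k) (padded X (suc k)) ⊎ E H (padded Y k) (padded Y (suc k))
  zipped-step {k} k< with length X ≟ 0
  ... | yes lX≡0 = inj₂ (padded-adjacent Y (≤-trans (s≤s z≤n) (subst (λ l → k < l ⊔ length Y) lX≡0 k<)) k)
  ... | no  lX≢0 = inj₁ (padded-adjacent X (n≢0⇒n>0 lX≢0) k)

  strongly : ℕPath (G ⊠ H) (x , y) (x′ , y′)
  strongly = record
    { length = zipLength ; at = zipped ; at-injective = zipped-injective
    ; at-start = zipped-start ; at-end = zipped-end
    ; at-adjacent = λ {k} k< → StrongE-step {G} {H} (padded-move X k) (padded-move Y k) (zipped-step k<)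
    }

  directly : 1 ≤ length X → 1 ≤ length Y → ℕPath (G ⨯ H) (x , y) (x′ , y′)
  directly 1≤lX 1≤lY = record
    { length = zipLength ; at = zipped ; at-injective = zipped-injective
    ; at-start = zipped-start ; at-end = zipped-end
    ; at-adjacent = λ {k} _ → padded-adjacent X 1≤lX k , padded-adjacent Y 1≤lY k
    }

module Links {G : Graph} {t : ℕ} (I : ℕImmersion G t) where

  link : ∀ i j → ℕPath G (terminal I i) (terminal I j)
  link i j with <-cmpᶠ i j
  ... | tri< i<j _ _  = route I i j i<j
  ... | tri≈ _ refl _ = trivial (terminal I i)
  ... | tri> _ _ j<i  = reverse (route I j i j<i)

  link-diagonal : ∀ i → length (link i i) ≡ 0
  link-diagonal i with <-cmpᶠ i i
  ... | tri< _ i≢i _  = contradiction refl i≢i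
  ... | tri≈ _ refl _ = refl
  ... | tri> _ i≢i _  = contradiction refl i≢i

  link-odd : ∀ {i j} → i ≢ j → odd (length (link i j)) ≡ true
  link-odd {i} {j} i≢j with <-cmpᶠ i j
  ... | tri< i<j _ _ = route-odd I i<j
  ... | tri≈ _ i≡j _ = contradiction i≡j i≢j
  ... | tri> _ _ j<i = route-odd I j<i

  link-ZeroOrOdd : ∀ i j → ZeroOrOdd (length (link i j))
  link-ZeroOrOdd i j with i ≟ᶠ j
  ... | yes refl = inj₁ (link-diagonal i)
  ... | no  i≢j  = inj₂ (link-odd i≢j)

  link-trivial : ∀ {i j} → length (link i j) ≡ 0 → i ≡ j
  link-trivial {i} {j} l≡0 with i ≟ᶠ j
  ... | yes i≡j = i≡j
  ... | no  i≢j = contradiction (trans (sym (cong odd l≡0)) (link-odd i≢j)) λ ()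

  link-reverse : ∀ i j → Reverses (link j i) (link i j)
  link-reverse i j with <-cmpᶠ i j | <-cmpᶠ j i
  ... | tri< i<j _ _  | tri> _ _ i<j′ rewrite <-irrelevant i<j′ i<j = reverse-Reverses (route I i j i<j)
  ... | tri> _ _ j<i  | tri< j<i′ _ _ rewrite <-irrelevant j<i′ j<i =
    Reverses-sym {Q = reverse (route I j i j<i)} {route I j i j<i} (reverse-Reverses (route I j i j<i))
  ... | tri≈ _ refl _ | tri≈ _ refl _ = refl , λ _ → refl
  ... | tri< _ _ j≮i  | tri< j<i _ _  = contradiction j<i j≮i
  ... | tri< _ i≢j _  | tri≈ _ j≡i _  = contradiction (sym j≡i) i≢j
  ... | tri≈ _ _ j≮i  | tri< j<i _ _  = contradiction j<i j≮i
  ... | tri≈ i≮j _ _  | tri> _ _ i<j  = contradiction i<j i≮j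
  ... | tri> i≮j _ _  | tri> _ _ i<j  = contradiction i<j i≮j
  ... | tri> _ i≢j _  | tri≈ _ j≡i _  = contradiction (sym j≡i) i≢j

  RouteEdge : Fin t → Fin t → V G → V G → Set
  RouteEdge i j a b = Σ (i <ᶠ j) λ i<j → EdgeOf (route I i j i<j) a b

  link-edge : ∀ {i j a b} → EdgeOf (link i j) a b → RouteEdge i j a b ⊎ RouteEdge j i a b
  link-edge {i} {j} e with <-cmpᶠ i j
  ... | tri< i<j _ _  = inj₁ (i<j , e)
  ... | tri≈ _ refl _ = contradiction (proj₁ (proj₂ e)) λ ()
  ... | tri> _ _ j<i  = inj₂ (j<i , EdgeOf-reverse (route I j i j<i) e)

  link-disjoint : ∀ {i j i′ j′ a b} → EdgeOf (link i j) a b → EdgeOf (link i′ j′) a b → SameEdge i j i′ j′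
  link-disjoint e e′ with link-edge e | link-edge e′
  ... | inj₁ (p , r) | inj₁ (p′ , r′) = inj₁ (route-disjoint I p p′ r r′)
  ... | inj₁ (p , r) | inj₂ (p′ , r′) = inj₂ (route-disjoint I p p′ r r′)
  ... | inj₂ (p , r) | inj₁ (p′ , r′) = inj₂ (swap (route-disjoint I p p′ r r′))
  ... | inj₂ (p , r) | inj₂ (p′ , r′) = inj₁ (swap (route-disjoint I p p′ r r′))

  link-interior : ∀ i j → InteriorAvoids (link i j) (Terminal I)
  link-interior i j with <-cmpᶠ i j
  ... | tri< i<j _ _  = route-interior I i<j
  ... | tri≈ _ refl _ = λ _ ()
  ... | tri> _ _ j<i  = λ 0<k k< → route-interior I j<i (m<n⇒0<n∸m k<) (∸-monoʳ-< 0<k (<⇒≤ k<))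

  padded-link-diagonal : ∀ i n → padded (link i i) n ≡ terminal I i
  padded-link-diagonal i = padded-trivial (link i i) (link-diagonal i)

  padded-link-adjacent : ∀ {i j} → i ≢ j → ∀ n → E G (padded (link i j) n) (padded (link i j) (suc n))
  padded-link-adjacent {i} {j} i≢j = padded-adjacent (link i j) (odd⇒1≤ (link-odd i≢j))

  padded-link-stuck : ∀ {i i′ j′ k m} → i′ ≢ j′ →
    ¬ SameEdge (padded (link i i) k) (padded (link i i) (suc k)) (padded (link i′ j′) m) (padded (link i′ j′) (suc m))
  padded-link-stuck {i} {k = k} {m} i′≢j′ se = E-irr G (subst (E G _) (sym (SameEdge-loop loop)) (padded-link-adjacent i′≢j′ m))
    where loop = SameEdge-cong (padded-link-diagonal i k) (padded-link-diagonal i (suc k)) refl refl se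

  padded-link-step : ∀ {i j i′ j′ k m} →
    SameEdge (padded (link i j) k) (padded (link i j) (suc k)) (padded (link i′ j′) m) (padded (link i′ j′) (suc m)) →
    SameEdge i j i′ j′
  padded-link-step {i} {j} {i′} {j′} {k} {m} se with i ≟ᶠ j | i′ ≟ᶠ j′
  ... | yes refl | yes refl = inj₁ (i≡i′ , i≡i′)
    where
    i≡i′ = terminal-injective I (reduce (SameEdge-head (SameEdge-cong
      (padded-link-diagonal i k) (padded-link-diagonal i (suc k)) (padded-link-diagonal i′ m) (padded-link-diagonal i′ (suc m)) se)))
  ... | yes refl | no i′≢j′ = contradiction se (padded-link-stuck {i} {i′} {j′} {k} {m} i′≢j′)
  ... | no i≢j   | yes refl = contradiction (SameEdge-sym se) (padded-link-stuck {i′} {i} {j} {m} {k} i≢j)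
  ... | no i≢j   | no i′≢j′ = link-disjoint (padded-edge (link i j) (odd⇒1≤ (link-odd i≢j)) k)
      (EdgeOf-SameEdge (link i′ j′) se (padded-edge (link i′ j′) (odd⇒1≤ (link-odd i′≢j′)) m))

⨯-immersion : ∀ {G H t} → ℕImmersion G t → ℕImmersion H t → ℕImmersion (G ⨯ H) t
⨯-immersion {G} {H} {t} I J = record
  { terminal = λ s → terminal I s , terminal J s
  ; terminal-injective = λ e → terminal-injective I (cong proj₁ e)
  ; route = λ i j i<j → Z.directly i<j (odd⇒1≤ (route-odd I i<j)) (odd⇒1≤ (route-odd J i<j))
  ; route-odd = λ i<j → Z.zipLength-odd i<j λ (l≡0 , _) → contradiction (trans (sym (cong odd l≡0)) (route-odd I i<j)) λ ()
  ; route-disjoint = λ i<j i′<j′ (_ , _ , se) (_ , _ , se′) → route-disjoint I i<j i′<j′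
      (Z.zipped-edgeˡ i<j (odd⇒1≤ (route-odd I i<j)) se) (Z.zipped-edgeˡ i′<j′ (odd⇒1≤ (route-odd I i′<j′)) se′)
  ; route-interior = λ i<j 0<k k< (s , e) →
      Z.zipped-interior i<j {Terminal I} {Terminal J} (route-interior I i<j) (route-interior J i<j) 0<k k<
        ((s , cong proj₁ e) , (s , cong proj₂ e))
  }
  where
  module Z {i j : Fin t} (i<j : i <ᶠ j) =
    Zip (route I i j i<j) (route J i j i<j) (inj₂ (route-odd I i<j)) (inj₂ (route-odd J i<j))

module StrongRoutes {G H : Graph} {a b : ℕ} (I : ℕImmersion G a) (J : ℕImmersion H b) where
  module LI = Links I
  module LJ = Links J
  module ZipLinks (i j : Fin a) (p q : Fin b) = Zip (LI.link i j) (LJ.link p q) (LI.link-ZeroOrOdd i j) (LJ.link-ZeroOrOdd p q)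

  StepsMeet : ∀ (i j : Fin a) (p q : Fin b) (i′ j′ : Fin a) (p′ q′ : Fin b) → ℕ → ℕ → Set
  StepsMeet i j p q i′ j′ p′ q′ k m =
    SameEdge (ZipLinks.zipped i j p q k) (ZipLinks.zipped i j p q (suc k))
             (ZipLinks.zipped i′ j′ p′ q′ m) (ZipLinks.zipped i′ j′ p′ q′ (suc m))

  crossedʳ : ∀ {i j p q k m} → StepsMeet i j p q i j q p k m → SameEdge (i , p) (j , q) (i , q) (j , p)
  crossedʳ {i} {j} {p} {q} {k} se with i ≟ᶠ j | p ≟ᶠ q
  ... | yes refl | _        = inj₂ (refl , refl)
  ... | no _     | yes refl = inj₁ (refl , refl)
  ... | no i≢j   | no p≢q   = contradiction (SameEdge-head se) [ apart , apart ]′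
    where
    apart : ∀ {m} → ZipLinks.zipped i j p q k ≢ ZipLinks.zipped i j q p m
    apart e = padded-crossing {X = LI.link i j} {LJ.link p q} {LJ.link q p}
      (odd⇒1≤ (LI.link-odd i≢j)) (LJ.link-odd p≢q) (LJ.link-reverse p q) (cong proj₁ e) (cong proj₂ e)

  crossedˡ : ∀ {i j p q k m} → StepsMeet i j p q j i p q k m → SameEdge (i , p) (j , q) (j , p) (i , q)
  crossedˡ {i} {j} {p} {q} {k} se with i ≟ᶠ j | p ≟ᶠ q
  ... | yes refl | _        = inj₁ (refl , refl)
  ... | no _     | yes refl = inj₂ (refl , refl)
  ... | no i≢j   | no p≢q   = contradiction (SameEdge-head se) [ apart , apart ]′
    where
    apart : ∀ {m} → ZipLinks.zipped i j p q k ≢ ZipLinks.zipped j i p q m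
    apart e = padded-crossing {X = LJ.link p q} {LI.link i j} {LI.link j i}
      (odd⇒1≤ (LJ.link-odd p≢q)) (LI.link-odd i≢j) (LI.link-reverse i j) (cong proj₂ e) (cong proj₁ e)

  steps-SameEdge : ∀ {i j p q i′ j′ p′ q′ k m} → StepsMeet i j p q i′ j′ p′ q′ k m →
                   SameEdge (i , p) (j , q) (i′ , p′) (j′ , q′)
  steps-SameEdge {i} {j} {p} {q} {i′} {j′} {p′} {q′} {k} {m} se
    with LI.padded-link-step {i} {j} {i′} {j′} {k} {m} (SameEdge-map proj₁ se)
       | LJ.padded-link-step {p} {q} {p′} {q′} {k} {m} (SameEdge-map proj₂ se)
  ... | inj₁ (refl , refl) | inj₁ (refl , refl) = inj₁ (refl , refl)
  ... | inj₂ (refl , refl) | inj₂ (refl , refl) = inj₂ (refl , refl)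
  ... | inj₁ (refl , refl) | inj₂ (refl , refl) = crossedʳ se
  ... | inj₂ (refl , refl) | inj₁ (refl , refl) = crossedˡ se

⊠-immersion : ∀ {G H a b} → ℕImmersion G a → ℕImmersion H b → ℕImmersion (G ⊠ H) (a * b)
⊠-immersion {G} {H} {a} {b} I J = record
  { terminal = λ u → terminal I (left u) , terminal J (right u)
  ; terminal-injective = λ e →
      split-injective (cong₂ _,_ (terminal-injective I (cong proj₁ e)) (terminal-injective J (cong proj₂ e)))
  ; route = λ u v _ → ZipLinks.strongly (left u) (left v) (right u) (right v)
  ; route-odd = λ {u} {v} u<v → ZipLinks.zipLength-odd (left u) (left v) (right u) (right v) (nontrivial u<v)
  ; route-disjoint = λ u<v u′<v′ (_ , _ , se) (_ , _ , se′) → SameEdge-ordered u<v u′<v′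
      (SameEdge-unmap split-injective (steps-SameEdge (SameEdge-trans (SameEdge-sym se) se′)))
  ; route-interior = λ {u} {v} _ 0<k k< (s , e) →
      ZipLinks.zipped-interior (left u) (left v) (right u) (right v) {Terminal I} {Terminal J}
        (LI.link-interior (left u) (left v)) (LJ.link-interior (right u) (right v)) 0<k k<
        ((left s , cong proj₁ e) , (right s , cong proj₂ e))
  }
  where
  open StrongRoutes I J
  split : Fin (a * b) → Fin a × Fin b
  split = remQuot {a} b
  left : Fin (a * b) → Fin a
  left u = proj₁ (split u)
  right : Fin (a * b) → Fin b
  right u = proj₂ (split u)
  split-injective : ∀ {u v} → split u ≡ split v → u ≡ v
  split-injective = Injection.injective (↔⇒↣ (*↔× {a} {b}))
  nontrivial : ∀ {u v} → u <ᶠ v → ¬ (length (LI.link (left u) (left v)) ≡ 0 × length (LJ.link (right u) (right v)) ≡ 0)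
  nontrivial u<v (l≡0 , l′≡0) =
    <-irrefl (cong toℕ (split-injective (cong₂ _,_ (LI.link-trivial l≡0) (LJ.link-trivial l′≡0)))) u<v

TOImmersion-⨯ : ∀ {G H t} → TOImmersion G t → TOImmersion H t → TOImmersion (G ⨯ H) t
TOImmersion-⨯ I J = toTOImmersion (⨯-immersion (fromTOImmersion I) (fromTOImmersion J))

TOImmersion-⊠ : ∀ {G H a b} → TOImmersion G a → TOImmersion H b → TOImmersion (G ⊠ H) (a * b)
TOImmersion-⊠ I J = toTOImmersion (⊠-immersion (fromTOImmersion I) (fromTOImmersion J))

ConjectureCertificate : Graph → Set
ConjectureCertificate G = ∃[ c ] Colourable G c × TOImmersion G c

¬¬certificate⇒satisfies : ∀ {G} → ¬ ¬ ConjectureCertificate G → SatisfiesConjecture G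
¬¬certificate⇒satisfies certified k t (_ , least) (_ , greatest) = decidable-stable (k ≤? t) λ k≰t →
  certified λ (c , colouring , immersion) → k≰t (≤-trans (least c colouring) (greatest c immersion))

satisfies⇒¬¬certificate : ∀ {G} → SatisfiesConjecture G → ¬ ¬ ConjectureCertificate G
satisfies⇒¬¬certificate {G} satisfies = do
  (k , χ)   ← ¬¬-chromaticNumber G
  (t , toi) ← ¬¬-toi G
  pure (t , Colourable-weaken {G} (satisfies k t χ toi) (proj₁ χ) , proj₁ toi)

certificate-product : ∀ ∗ {G H} → V G → V H → ConjectureCertificate G → ConjectureCertificate H →
                      ConjectureCertificate (G ⟨ ∗ ⟩ H)
certificate-product cartesian {G} {H} g h (a , cG , iG) (b , cH , iH) with ≤-total a b
... | inj₁ a≤b = b , Colourable-□ {G} {H} (Colourable-weaken {G} a≤b cG) cH , TOImmersion-map (□-layerʳ {G} {H} g) iH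
... | inj₂ b≤a = a , Colourable-□ {G} {H} cG (Colourable-weaken {H} b≤a cH) , TOImmersion-map (□-layerˡ {G} {H} h) iG
certificate-product direct {G} {H} _ _ (a , cG , iG) (b , cH , iH) with ≤-total a b
... | inj₁ a≤b = a , Colourable-pullback (⨯⇒left {G} {H}) cG , TOImmersion-⨯ iG (TOImmersion-restrict a≤b iH)
... | inj₂ b≤a = b , Colourable-pullback (⨯⇒right {G} {H}) cH , TOImmersion-⨯ (TOImmersion-restrict b≤a iG) iH
certificate-product strong {G} {H} _ _ (a , cG , iG) (b , cH , iH) =
  a * b , Colourable-pullback (⊠⇒∘ᴳ {G} {H}) (Colourable-∘ᴳ {G} {H} cG cH) , TOImmersion-⊠ iG iH
certificate-product lexicographic {G} {H} _ _ (a , cG , iG) (b , cH , iH) =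
  a * b , Colourable-∘ᴳ {G} {H} cG cH , TOImmersion-map (⊠⇒∘ᴳ {G} {H} , λ same → same) (TOImmersion-⊠ iG iH)

order-⟨⟩ : ∀ ∗ G H → order (G ⟨ ∗ ⟩ H) ≡ order G * order H
order-⟨⟩ cartesian     _ _ = refl
order-⟨⟩ direct        _ _ = refl
order-⟨⟩ lexicographic _ _ = refl
order-⟨⟩ strong        _ _ = refl

factors<product : ∀ {m n} → 2 ≤ m → 2 ≤ n → m < m * n × n < m * n
factors<product {m@(suc _)} {n@(suc _)} 2≤m 2≤n = m<m*n m n 2≤n , subst (n <_) (*-comm n m) (m<m*n n m 2≤m)

vertex : ∀ G → 1 ≤ order G → V G
vertex G 1≤|G| = Inverse.from (enum G) (fromℕ< 1≤|G|)

corollary5 : (∗ : Product) (G H : Graph) → 2 ≤ order G → 2 ≤ order H →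
    ¬ MinimumCounterexample (G ⟨ ∗ ⟩ H)
corollary5 ∗ G H 2≤|G| 2≤|H| (counterexample , minimal) = counterexample (¬¬certificate⇒satisfies (do
  certificateG ← satisfies⇒¬¬certificate (minimal G |G|<|G∗H|)
  certificateH ← satisfies⇒¬¬certificate (minimal H |H|<|G∗H|)
  pure (certificate-product ∗ (vertex G (<⇒≤ 2≤|G|)) (vertex H (<⇒≤ 2≤|H|)) certificateG certificateH)))
  where
  |G|<|G∗H| : order G < order (G ⟨ ∗ ⟩ H)
  |G|<|G∗H| = subst (order G <_) (sym (order-⟨⟩ ∗ G H)) (proj₁ (factors<product 2≤|G| 2≤|H|))
  |H|<|G∗H| : order H < order (G ⟨ ∗ ⟩ H)
  |H|<|G∗H| = subst (order H <_) (sym (order-⟨⟩ ∗ G H)) (proj₂ (factors<product 2≤|G| 2≤|H|))
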